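{- Let $G$ and $H$ be cographs and let $k=|V(H)|$. If $H$ is a retract of $G$, then $\omega(G)=\omega(H)\le k$; moreover, if $T_G$ is a cotree for $G$, then every join-node ($\otimes$-node) of $T_G$ has at most $k$ children, and the height of $T_G$ is $O(k)$.
   Context: All graphs are finite and simple; $\omega$ denotes the clique number. A cograph is a graph with no induced subgraph isomorphic to $P_4$. A homomorphism $\phi: G\to H$ is a map $V(G)\to V(H)$ preserving edges; $H$ is a retract of $G$ if there exist homomorphisms $\rho: G\to H$ and $\gamma: H\to G$ with $\rho\circ\gamma=\mathrm{id}_{V(H)}$. A cotree for a cograph $G$ is a rooted tree whose leaves are in bijection with $V(G)$ and whose internal nodes are labeled $\oplus$ (the graph of the node is the disjoint union of the graphs of its children) or $\otimes$ (the graph of the node is the join of the graphs of its children), with the graph of the root equal to $G$; in this paper the labels of internal nodes alternate between $\oplus$ and $\otimes$ along every root-to-leaf path (so the children of a $\oplus$-node correspond to components and the children of a $\otimes$-node to cocomponents of the node's graph). -}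

module Defs where

open import Data.Nat using (ℕ; zero; suc; _≤_; _⊔_)
open import Data.Fin using (Fin; zero; suc)
open import Data.Fin.Properties using (_≟_)
open import Data.Bool using (Bool; true; false)
open import Data.Product using (Σ; _×_; _,_; ∃)
open import Data.Sum using (_⊎_)
open import Data.Unit using (⊤; tt)
open import Data.Empty using (⊥)
open import Relation.Nullary using (¬_; Dec; yes; no)
open import Relation.Binary.PropositionalEquality using (_≡_; _≢_; refl)
open import Function.Definitions using (Injective; Bijective)

record Graph : Set where
  field
    n      : ℕ
    E      : Fin n → Fin n → Bool
    sym    : ∀ u v → E u v ≡ E v u
    irrefl : ∀ u → E u u ≡ false
open Graph public

P4 : Fin 4 → Fin 4 → Bool
P4 zero (suc zero) = true
P4 (suc zero) zero = true
P4 (suc zero) (suc (suc zero)) = true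
P4 (suc (suc zero)) (suc zero) = true
P4 (suc (suc zero)) (suc (suc (suc zero))) = true
P4 (suc (suc (suc zero))) (suc (suc zero)) = true
P4 _ _ = false

HasInducedP4 : Graph → Set
HasInducedP4 G = Σ (Fin 4 → Fin (n G)) λ f →
  Injective _≡_ _≡_ f × (∀ i j → E G (f i) (f j) ≡ P4 i j)

IsCograph : Graph → Set
IsCograph G = ¬ HasInducedP4 G

IsHom : (G H : Graph) → (Fin (n G) → Fin (n H)) → Set
IsHom G H f = ∀ u v → E G u v ≡ true → E H (f u) (f v) ≡ true

IsRetract : (H G : Graph) → Set
IsRetract H G = Σ (Fin (n G) → Fin (n H)) λ ρ → Σ (Fin (n H) → Fin (n G)) λ γ →
  IsHom G H ρ × IsHom H G γ × (∀ x → ρ (γ x) ≡ x)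

HasClique : Graph → ℕ → Set
HasClique G k = Σ (Fin k → Fin (n G)) λ f →
  Injective _≡_ _≡_ f × (∀ i j → i ≢ j → E G (f i) (f j) ≡ true)

IsCliqueNumber : Graph → ℕ → Set
IsCliqueNumber G w = HasClique G w × (∀ k → HasClique G k → k ≤ w)

data Label : Set where
  ⊕ ⊗ : Label

other : Label → Label
other ⊕ = ⊗
other ⊗ = ⊕

data Tree (k : ℕ) : Set where
  leaf : Fin k → Tree k
  node : Label → (m : ℕ) → (Fin m → Tree k) → Tree k

module _ {k : ℕ} where

  Leaf : Tree k → Set
  Leaf (leaf v) = ⊤
  Leaf (node ℓ m ch) = Σ (Fin m) λ i → Leaf (ch i)

  lab : (T : Tree k) → Leaf T → Fin k
  lab (leaf v) tt = v
  lab (node ℓ m ch) (i , x) = lab (ch i) x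

  -- adjacency in the graph of the tree, computed recursively:
  -- ⊕ = disjoint union of children's graphs, ⊗ = join of children's graphs
  nodeAdj : Label → Set
  nodeAdj ⊕ = ⊥
  nodeAdj ⊗ = ⊤

  TAdj : (T : Tree k) → Leaf T → Leaf T → Set
  TAdj (leaf v) x y = ⊥
  TAdj (node ℓ m ch) (i , x) (j , y) with i ≟ j
  ... | yes refl = TAdj (ch i) x y
  ... | no _ = nodeAdj ℓ

  ChildOk : Label → Tree k → Set
  ChildOk ℓ (leaf v) = ⊤
  ChildOk ℓ (node ℓ' m ch) = ℓ' ≡ other ℓ

  WellFormed : Tree k → Set
  WellFormed (leaf v) = ⊤
  WellFormed (node ℓ m ch) = 2 ≤ m × (∀ i → ChildOk ℓ (ch i) × WellFormed (ch i))

  maxF : (m : ℕ) → (Fin m → ℕ) → ℕ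
  maxF zero f = 0
  maxF (suc m) f = f zero ⊔ maxF m (λ i → f (suc i))

  height : Tree k → ℕ
  height (leaf v) = 0
  height (node ℓ m ch) = suc (maxF m (λ i → height (ch i)))

  JoinsBounded : ℕ → Tree k → Set
  JoinsBounded b (leaf v) = ⊤
  JoinsBounded b (node ℓ m ch) = (ℓ ≡ ⊗ → m ≤ b) × (∀ i → JoinsBounded b (ch i))

IsCotree : (G : Graph) → Tree (n G) → Set
IsCotree G T = WellFormed T × Bijective _≡_ _≡_ (lab T) ×
  (∀ x y → (TAdj T x y → E G (lab T x) (lab T y) ≡ true)
         × (E G (lab T x) (lab T y) ≡ true → TAdj T x y))

module Submission where

-- Let ρ : G → H and γ : H → G be the homomorphisms of the retraction.
-- (1) A homomorphism maps a clique to a clique of the same size (distinct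
--     vertices of a clique are adjacent, so their images stay distinct).
--     Using ρ and γ, ω(G) = ω(H); and a clique of H has at most |V(H)| vertices.
-- (2) A clique of the graph of a cotree T of G is a clique of G, so every
--     clique of T has at most |V(H)| vertices.  A ⊗-node with m children
--     carries a clique of size m (one leaf below each child), hence m ≤ |V(H)|.
-- (3) Because labels alternate, descending along a tallest path through T
--     picks up a new clique vertex at every ⊗-node, i.e. at least at every
--     second level: every well-formed tree has a clique of size c with
--     height < 2c.  Hence height T < 2|V(H)|, so C = 2 works.

open import Defs
open import Data.Nat using (ℕ; _≤_; _*_)
open import Data.Product using (Σ; _×_)
open import Relation.Binary.PropositionalEquality using (_≡_)

open import Data.Nat using (zero; suc; _+_; s≤s)
open import Data.Nat.Properties
  using (≤-refl; ≤-trans; ≤-antisym; ≤-total; ⊔-lub; ⊔-identityʳ; +-suc; +-identityʳ; +-mono-≤; n≤1+n; module ≤-Reasoning)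
open import Data.Fin using (Fin; zero; suc; punchIn)
open import Data.Fin.Properties using (_≟_; injective⇒≤; punchInᵢ≢i)
open import Data.Bool using (true)
open import Data.Product using (_,_; proj₁; proj₂)
open import Data.Sum using (inj₁; inj₂)
open import Data.Unit using (tt)
open import Data.Empty using (⊥-elim)
open import Function.Definitions using (Injective)
open import Relation.Nullary using (yes; no)
open import Relation.Binary.PropositionalEquality using (_≢_; refl; cong; subst) renaming (sym to ≡-sym)

edge⇒distinct : (G : Graph) → ∀ u v → E G u v ≡ true → u ≢ v
edge⇒distinct G u .u e refl with subst (_≡ true) (irrefl G u) e
... | ()

adjacentFamily⇒clique : (G : Graph) {c : ℕ} (f : Fin c → Fin (n G)) →
  (∀ i j → i ≢ j → E G (f i) (f j) ≡ true) → HasClique G c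
adjacentFamily⇒clique G f adj = f , injective , adj
  where
  injective : Injective _≡_ _≡_ f
  injective {i} {j} eq with i ≟ j
  ... | yes i≡j = i≡j
  ... | no i≢j = ⊥-elim (edge⇒distinct G _ _ (adj i j i≢j) eq)

hom-preservesClique : (G H : Graph) (φ : Fin (n G) → Fin (n H)) → IsHom G H φ →
  ∀ {c} → HasClique G c → HasClique H c
hom-preservesClique G H φ hom (f , _ , adj) =
  adjacentFamily⇒clique H (λ i → φ (f i)) (λ i j i≢j → hom _ _ (adj i j i≢j))

clique≤order : (G : Graph) → ∀ {c} → HasClique G c → c ≤ n G
clique≤order G (_ , injective , _) = injective⇒≤ injective

homEquivalent⇒sameCliqueNumber : (G H : Graph)
  (φ : Fin (n G) → Fin (n H)) (ψ : Fin (n H) → Fin (n G)) → IsHom G H φ → IsHom H G ψ →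
  ∀ ωG ωH → IsCliqueNumber G ωG → IsCliqueNumber H ωH → ωG ≡ ωH
homEquivalent⇒sameCliqueNumber G H φ ψ homφ homψ ωG ωH (cliqueG , maxG) (cliqueH , maxH) =
  ≤-antisym (maxH ωG (hom-preservesClique G H φ homφ cliqueG))
            (maxG ωH (hom-preservesClique H G ψ homψ cliqueH))

module _ {k : ℕ} where

  TClique : Tree k → ℕ → Set
  TClique S c = Σ (Fin c → Leaf S) λ f → ∀ i j → i ≢ j → TAdj S (f i) (f j)

  CliquesBoundedBy : ℕ → Tree k → Set
  CliquesBoundedBy b S = ∀ c → TClique S c → c ≤ b

  sameChildAdj : ∀ ℓ m (ch : Fin m → Tree k) i x y →
    TAdj (ch i) x y → TAdj (node ℓ m ch) (i , x) (i , y)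
  sameChildAdj ℓ m ch i x y a with i ≟ i
  ... | yes refl = a
  ... | no i≢i = ⊥-elim (i≢i refl)

  joinAdj : ∀ m (ch : Fin m → Tree k) i j x y → i ≢ j → TAdj (node ⊗ m ch) (i , x) (j , y)
  joinAdj m ch i j x y i≢j with i ≟ j
  ... | yes i≡j = ⊥-elim (i≢j i≡j)
  ... | no _ = tt

  childClique⇒clique : ∀ ℓ m (ch : Fin m → Tree k) i {c} → TClique (ch i) c → TClique (node ℓ m ch) c
  childClique⇒clique ℓ m ch i (f , adj) =
    (λ a → i , f a) , λ a b a≢b → sameChildAdj ℓ m ch i (f a) (f b) (adj a b a≢b)

  extendJoinClique : ∀ m (ch : Fin m → Tree k) i j → i ≢ j → Leaf (ch j) →
    ∀ {c} → TClique (ch i) c → TClique (node ⊗ m ch) (suc c)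
  extendJoinClique m ch i j i≢j y (f , adj) = g , gAdj
    where
    g : Fin (suc _) → Leaf (node ⊗ m ch)
    g zero = j , y
    g (suc a) = i , f a
    gAdj : ∀ a b → a ≢ b → TAdj (node ⊗ m ch) (g a) (g b)
    gAdj zero zero a≢b = ⊥-elim (a≢b refl)
    gAdj zero (suc b) _ = joinAdj m ch j i _ _ (λ j≡i → i≢j (≡-sym j≡i))
    gAdj (suc a) zero _ = joinAdj m ch i j _ _ i≢j
    gAdj (suc a) (suc b) a≢b = sameChildAdj ⊗ m ch i (f a) (f b) (adj a b (λ a≡b → a≢b (cong suc a≡b)))

  someLeaf : (S : Tree k) → WellFormed S → Leaf S
  someLeaf (leaf v) _ = tt
  someLeaf (node ℓ (suc m) ch) (s≤s _ , wf) = zero , someLeaf (ch zero) (proj₂ (wf zero))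

  joinChildrenClique : ∀ m (ch : Fin m → Tree k) → (∀ i → WellFormed (ch i)) → TClique (node ⊗ m ch) m
  joinChildrenClique m ch wf =
    (λ i → i , someLeaf (ch i) (wf i)) , λ i j i≢j → joinAdj m ch i j _ _ i≢j

  cliquesBounded⇒joinsBounded : ∀ b (S : Tree k) → WellFormed S → CliquesBoundedBy b S → JoinsBounded b S
  cliquesBounded⇒joinsBounded b (leaf v) _ _ = tt
  cliquesBounded⇒joinsBounded b (node ℓ m ch) (_ , wf) bounded = rootBounded , childBounded
    where
    rootBounded : ℓ ≡ ⊗ → m ≤ b
    rootBounded refl = bounded m (joinChildrenClique m ch (λ i → proj₂ (wf i)))
    childBounded : ∀ i → JoinsBounded b (ch i)
    childBounded i = cliquesBounded⇒joinsBounded b (ch i) (proj₂ (wf i))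
      (λ c cl → bounded c (childClique⇒clique ℓ m ch i cl))

  maxF-attained : ∀ m (f : Fin (suc m) → ℕ) → Σ (Fin (suc m)) λ i → maxF {k} (suc m) f ≤ f i
  maxF-attained zero f = zero , subst (_≤ f zero) (≡-sym (⊔-identityʳ (f zero))) ≤-refl
  maxF-attained (suc m) f with maxF-attained m (λ i → f (suc i))
  ... | j , maxTail≤fj with ≤-total (f zero) (f (suc j))
  ... | inj₁ f0≤fj = suc j , ⊔-lub f0≤fj maxTail≤fj
  ... | inj₂ fj≤f0 = zero , ⊔-lub ≤-refl (≤-trans maxTail≤fj fj≤f0)

  -- A ⊗-node adds a
  -- vertex to the clique of its tallest child, a ⊕-node just passes it on.
  mutual
    joinRootedClique : (S : Tree k) → ChildOk ⊕ S → WellFormed S →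
      Σ ℕ λ c → TClique S c × (suc (suc (height S)) ≤ c + c)
    joinRootedClique (leaf v) _ _ =
      1 , ((λ _ → tt) , λ { zero zero 0≢0 → ⊥-elim (0≢0 refl) }) , ≤-refl
    joinRootedClique (node .⊗ (suc (suc m)) ch) refl (s≤s (s≤s _) , wf)
      with maxF-attained (suc m) (λ i → height (ch i))
    ... | i , tallest with unionRootedClique (ch i) (proj₁ (wf i)) (proj₂ (wf i))
    ... | c , clique , deep =
      suc c , extendJoinClique _ ch i j i≢j (someLeaf (ch j) (proj₂ (wf j))) clique ,
      (begin
        suc (suc (suc (maxF {k} (suc (suc m)) (λ i → height (ch i))))) ≤⟨ s≤s (s≤s (s≤s tallest)) ⟩
        suc (suc (suc (height (ch i))))                                 ≤⟨ s≤s (s≤s deep) ⟩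
        suc (suc (c + c))                                               ≡⟨ cong suc (≡-sym (+-suc c c)) ⟩
        suc c + suc c                                                   ∎)
      where
      open ≤-Reasoning
      -- some child other than the tallest one (there are at least two)
      j : Fin (suc (suc m))
      j = punchIn i zero
      i≢j : i ≢ j
      i≢j i≡j = punchInᵢ≢i i zero (≡-sym i≡j)

    unionRootedClique : (S : Tree k) → ChildOk ⊗ S → WellFormed S →
      Σ ℕ λ c → TClique S c × (suc (height S) ≤ c + c)
    unionRootedClique (leaf v) _ wf with joinRootedClique (leaf v) tt wf
    ... | c , clique , deep = c , clique , ≤-trans (n≤1+n _) deep
    unionRootedClique (node .⊕ (suc m) ch) refl (s≤s _ , wf)
      with maxF-attained m (λ i → height (ch i))
    ... | i , tallest with joinRootedClique (ch i) (proj₁ (wf i)) (proj₂ (wf i))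
    ... | c , clique , deep = c , childClique⇒clique ⊕ _ ch i clique , ≤-trans (s≤s (s≤s tallest)) deep

  deepClique : (S : Tree k) → WellFormed S → Σ ℕ λ c → TClique S c × (suc (height S) ≤ c + c)
  deepClique (leaf v) wf = unionRootedClique (leaf v) tt wf
  deepClique (node ⊕ m ch) wf = unionRootedClique (node ⊕ m ch) refl wf
  deepClique (node ⊗ m ch) wf with joinRootedClique (node ⊗ m ch) refl wf
  ... | c , clique , deep = c , clique , ≤-trans (n≤1+n _) deep

cotreeClique⇒clique : (G : Graph) (T : Tree (n G)) → IsCotree G T → ∀ {c} → TClique T c → HasClique G c
cotreeClique⇒clique G T (_ , _ , sameAdj) (f , adj) =
  adjacentFamily⇒clique G (λ i → lab T (f i)) (λ i j i≢j → proj₁ (sameAdj (f i) (f j)) (adj i j i≢j))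

cotreeCliquesBounded : (G H : Graph) (φ : Fin (n G) → Fin (n H)) → IsHom G H φ →
  (T : Tree (n G)) → IsCotree G T → CliquesBoundedBy (n H) T
cotreeCliquesBounded G H φ hom T cotree c clique =
  clique≤order H (hom-preservesClique G H φ hom (cotreeClique⇒clique G T cotree clique))

height≤double : ∀ h c b → suc h ≤ c + c → c ≤ b → h ≤ 2 * b
height≤double h c b h<2c c≤b = begin
  h         ≤⟨ n≤1+n h ⟩
  suc h     ≤⟨ h<2c ⟩
  c + c     ≤⟨ +-mono-≤ c≤b c≤b ⟩
  b + b     ≡⟨ cong (b +_) (≡-sym (+-identityʳ b)) ⟩
  2 * b     ∎
  where open ≤-Reasoning

mainTheorem9 : Σ ℕ λ C → (G H : Graph) → IsCograph G → IsCograph H → IsRetract H G →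
    ((ωG ωH : ℕ) → IsCliqueNumber G ωG → IsCliqueNumber H ωH → (ωG ≡ ωH) × (ωH ≤ n H))
    × ((T : Tree (n G)) → IsCotree G T → JoinsBounded (n H) T × (height T ≤ C * n H))
mainTheorem9 = 2 , λ G H _ _ (ρ , γ , homρ , homγ , _) → cliqueNumbers G H ρ γ homρ homγ , cotreeShape G H ρ homρ
  where
  cliqueNumbers : (G H : Graph) (ρ : Fin (n G) → Fin (n H)) (γ : Fin (n H) → Fin (n G)) →
    IsHom G H ρ → IsHom H G γ →
    (ωG ωH : ℕ) → IsCliqueNumber G ωG → IsCliqueNumber H ωH → (ωG ≡ ωH) × (ωH ≤ n H)
  cliqueNumbers G H ρ γ homρ homγ ωG ωH isωG isωH =
    homEquivalent⇒sameCliqueNumber G H ρ γ homρ homγ ωG ωH isωG isωH , clique≤order H (proj₁ isωH)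

  cotreeShape : (G H : Graph) (ρ : Fin (n G) → Fin (n H)) → IsHom G H ρ →
    (T : Tree (n G)) → IsCotree G T → JoinsBounded (n H) T × (height T ≤ 2 * n H)
  cotreeShape G H ρ homρ T cotree with deepClique T (proj₁ cotree)
  ... | c , clique , deep =
    cliquesBounded⇒joinsBounded (n H) T (proj₁ cotree) bounded ,
    height≤double (height T) c (n H) deep (bounded c clique)
    where
    bounded : CliquesBoundedBy (n H) T
    bounded = cotreeCliquesBounded G H ρ homρ T cotree
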